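{- For all $n\ge 1$, $$\left|\mathrm{Av}_n[\overline{123},\overline{321}]\right|=\begin{cases}1 & n=1,\\ 0 & n\ge 3\text{ odd},\\ U_{n-1} & n\ge 2\text{ even},\end{cases}$$ where $U_m$ is the number of up-down permutations of length $m$.
   Context: For $\sigma\in S_n$, the cyclic permutation $[\sigma]$ is the set of all rotations of $\sigma$; $[S_n]$ is the set of cyclic permutations of length $n$. $[\sigma]$ contains the totally vincular cyclic pattern $[\overline{abc}]$ if some three cyclically consecutive entries $\sigma_i\sigma_{i+1}\sigma_{i+2}$ (indices mod $n$, $n\ge 3$) are order-isomorphic to $abc$; otherwise it avoids it. $\mathrm{Av}_n[\overline{123},\overline{321}]$ is the set of cyclic permutations in $[S_n]$ avoiding both $[\overline{123}]$ and $[\overline{321}]$. An up-down permutation of length $m$ is $\tau\in S_m$ with $\tau_1<\tau_2>\tau_3<\tau_4>\cdots$; $U_m$ counts them (so $U_1=1$). -}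

module Defs where

open import Data.Nat using (ℕ; zero; suc; _<_; _≤_; _>_; _%_; _<?_)
open import Data.Nat.Properties using (_≟_)
open import Data.List using (List; []; _∷_; length; map; concatMap; filter; upTo; drop; take; _++_)
open import Data.List.Properties using (≡-dec)
open import Data.List.Relation.Unary.All using (All; all?)
open import Data.List.Relation.Unary.Any using (Any; any?)
open import Data.List.Relation.Unary.Unique.Propositional using (Unique)
import Data.List.Relation.Unary.Unique.DecPropositional as UDec
open import Data.Product using (_×_; ∃-syntax; _,_)
open import Data.Sum using (_⊎_)
open import Data.Unit using (⊤; tt)
open import Relation.Nullary using (Dec; yes; no; ¬_; ¬?)
open import Relation.Nullary.Decidable using (_×-dec_; _⊎-dec_)
open import Relation.Unary using (Decidable)
open import Relation.Binary.PropositionalEquality using (_≡_)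

-- Permutations of length n are represented in one-line notation as
-- lists σ = σ₀ σ₁ … σₙ₋₁ of the values 0,1,…,n-1 (0-based values;
-- pattern containment only depends on relative order).

words : ℕ → ℕ → List (List ℕ)
words n zero    = [] ∷ []
words n (suc k) = concatMap (λ i → map (i ∷_) (words n k)) (upTo n)

S : ℕ → List (List ℕ)
S n = filter (UDec.unique? _≟_) (words n n)

-- i-th entry of a list (default 0, never used out of range below)
nth : List ℕ → ℕ → ℕ
nth []       _       = 0
nth (x ∷ xs) zero    = x
nth (x ∷ xs) (suc i) = nth xs i

-- i mod n (with i mod 0 = i; only used for n = length σ ≥ 1)
_mod′_ : ℕ → ℕ → ℕ
i mod′ zero    = i
i mod′ (suc k) = i % suc k

cyc : List ℕ → ℕ → ℕ
cyc σ i = nth σ (i mod′ length σ)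

rotate : ℕ → List ℕ → List ℕ
rotate k σ = drop k σ ++ take k σ

_∼rot_ : List ℕ → List ℕ → Set
σ ∼rot τ = Any (λ k → τ ≡ rotate k σ) (upTo (length σ))

_∼rot?_ : (σ τ : List ℕ) → Dec (σ ∼rot τ)
σ ∼rot? τ = any? (λ k → ≡-dec _≟_ τ (rotate k σ)) (upTo (length σ))

-- number of equivalence classes (w.r.t. a decidable equivalence R)
-- met by the elements of a list: each element is counted iff no later
-- element of the list is R-related to it.
numClasses : {A : Set} {R : A → A → Set} →
             ((x y : A) → Dec (R x y)) → List A → ℕ
numClasses R? [] = 0
numClasses R? (x ∷ xs) with any? (R? x) xs
... | yes _ = numClasses R? xs
... | no  _ = suc (numClasses R? xs)

Occ123 : List ℕ → ℕ → Set
Occ123 σ i = (cyc σ i < cyc σ (suc i)) × (cyc σ (suc i) < cyc σ (suc (suc i)))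

Occ321 : List ℕ → ℕ → Set
Occ321 σ i = (cyc σ i > cyc σ (suc i)) × (cyc σ (suc i) > cyc σ (suc (suc i)))

-- [σ] contains [‾123] (resp. [‾321]); only defined for n ≥ 3, so we
-- include the hypothesis 3 ≤ n in containment.
Contains123 : List ℕ → Set
Contains123 σ = (3 ≤ length σ) × Any (Occ123 σ) (upTo (length σ))

Contains321 : List ℕ → Set
Contains321 σ = (3 ≤ length σ) × Any (Occ321 σ) (upTo (length σ))

Avoids : List ℕ → Set
Avoids σ = ¬ Contains123 σ × ¬ Contains321 σ

avoids? : (σ : List ℕ) → Dec (Avoids σ)
avoids? σ = ¬? c123 ×-dec ¬? c321
  where
  n = length σ
  c123 : Dec (Contains123 σ)
  c123 = (3 Data.Nat.≤? n) ×-dec any? (λ i → (cyc σ i <? cyc σ (suc i)) ×-dec (cyc σ (suc i) <? cyc σ (suc (suc i)))) (upTo n)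
  c321 : Dec (Contains321 σ)
  c321 = (3 Data.Nat.≤? n) ×-dec any? (λ i → (cyc σ (suc i) <? cyc σ i) ×-dec (cyc σ (suc (suc i)) <? cyc σ (suc i))) (upTo n)

-- |Av_n[‾123,‾321]| : number of cyclic permutations [σ] ∈ [S_n]
-- (rotation classes of S n) avoiding both patterns.  Avoidance of a
-- totally vincular cyclic pattern is invariant under rotation, so these
-- are the rotation classes of the avoiding permutations.
numAv : ℕ → ℕ
numAv n = numClasses _∼rot?_ (filter avoids? (S n))

mutual
  Up : List ℕ → Set
  Up []           = ⊤
  Up (x ∷ [])     = ⊤
  Up (x ∷ y ∷ r)  = (x < y) × Down (y ∷ r)

  Down : List ℕ → Set
  Down []          = ⊤
  Down (x ∷ [])    = ⊤
  Down (x ∷ y ∷ r) = (x > y) × Up (y ∷ r)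

mutual
  up? : (τ : List ℕ) → Dec (Up τ)
  up? []          = yes tt
  up? (x ∷ [])    = yes tt
  up? (x ∷ y ∷ r) = (x <? y) ×-dec down? (y ∷ r)

  down? : (τ : List ℕ) → Dec (Down τ)
  down? []          = yes tt
  down? (x ∷ [])    = yes tt
  down? (x ∷ y ∷ r) = (y <? x) ×-dec up? (y ∷ r)

U : ℕ → ℕ
U m = length (filter up? (S m))

module Submission where

-- Rotate a cyclic permutation of {0,…,n-1} so that its maximum m = n-1 comes first: every
-- rotation class contains exactly one such word m ∷ τ, where τ is a permutation of {0,…,m-1}.
-- Reading the cycle linearly as m ∷ τ ++ m ∷ head τ, avoiding [‾123] and [‾321] says that this
-- word has no monotone run of three consecutive entries, i.e. that it alternates; as it starts
-- with a descent from m, τ is up-down.  When τ has even length (n odd) it ends with an ascent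
-- into m, a cyclic 123, so there are no avoiders.  When τ has odd length (n even) the converse
-- holds as well, so the avoiding classes correspond to the up-down permutations τ of length n-1.

open import Defs
open import Data.Empty using (⊥-elim)
open import Data.Fin using (Fin; toℕ; fromℕ<)
open import Data.Fin.Properties using (toℕ<n; toℕ-fromℕ<; toℕ-injective; injective⇒≤)
open import Data.List
  using (List; []; _∷_; length; map; concatMap; cartesianProductWith; filter; upTo; drop; take; _++_)
open import Data.List.Properties
  using ( length-++; length-take; length-drop; length-map; filter-all; filter-none
        ; ++-identityʳ; ∷-injective; ∷-injectiveʳ; take++drop≡id)
open import Data.List.Membership.Propositional using (_∈_; find; lose)
open import Data.List.Membership.Propositional.Properties
  using ( ∈-upTo⁺; ∈-upTo⁻; ∈-filter⁺; ∈-filter⁻; ∈-map⁺; ∈-map⁻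
        ; ∈-cartesianProductWith⁺; ∈-cartesianProductWith⁻)
open import Data.List.Relation.Unary.All as All using (All; []; _∷_)
open import Data.List.Relation.Unary.Any as Any using (Any; here; there; any?)
open import Data.List.Relation.Unary.Unique.Propositional using (Unique; []; _∷_)
import Data.List.Relation.Unary.Unique.Propositional.Properties as Unique
import Data.List.Relation.Unary.Unique.DecPropositional as UniqueDec
open import Data.List.Relation.Binary.Permutation.Propositional using (_↭_; ↭-sym; ↭⇒↭ₛ)
open import Data.List.Relation.Binary.Permutation.Propositional.Properties
  using (↭-length; ++-comm; All-resp-↭)
open import Data.List.Relation.Binary.Permutation.Setoid.Properties using (Unique-resp-↭)
open import Data.Nat
open import Data.Nat.DivMod
open import Data.Nat.Properties
open import Algebra.Properties.CommutativeSemigroup +-commutativeSemigroup using (x∙yz≈y∙xz)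
open import Data.List.Membership.DecPropositional _≟_ using (_∈?_)
open import Data.Product using (_×_; _,_; ∃; proj₁)
open import Data.Unit using (tt)
open import Function using (_∘_)
open import Function.Definitions using (Injective)
open import Relation.Binary.PropositionalEquality
open import Relation.Nullary using (Dec; ¬_; yes; no)
open import Relation.Unary using (Decidable)

nth-++ˡ : ∀ (xs ys : List ℕ) {i} → i < length xs → nth (xs ++ ys) i ≡ nth xs i
nth-++ˡ (x ∷ xs) ys {zero}  _         = refl
nth-++ˡ (x ∷ xs) ys {suc i} (s≤s i<n) = nth-++ˡ xs ys i<n

nth-++ʳ : ∀ (xs ys : List ℕ) i → nth (xs ++ ys) (length xs + i) ≡ nth ys i
nth-++ʳ []       ys i = refl
nth-++ʳ (x ∷ xs) ys i = nth-++ʳ xs ys i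

nth-drop : ∀ k (xs : List ℕ) i → nth (drop k xs) i ≡ nth xs (k + i)
nth-drop zero    xs       i = refl
nth-drop (suc k) []       i = refl
nth-drop (suc k) (x ∷ xs) i = nth-drop k xs i

nth-take : ∀ k (xs : List ℕ) {i} → i < k → nth (take k xs) i ≡ nth xs i
nth-take (suc k) []       _         = refl
nth-take (suc k) (x ∷ xs) {zero}  _         = refl
nth-take (suc k) (x ∷ xs) {suc i} (s≤s i<k) = nth-take k xs i<k

nth-ext : ∀ {xs ys : List ℕ} → length xs ≡ length ys →
          (∀ i → i < length xs → nth xs i ≡ nth ys i) → xs ≡ ys
nth-ext {[]}     {[]}     _  _  = refl
nth-ext {x ∷ xs} {y ∷ ys} eq pt =
  cong₂ _∷_ (pt 0 z<s) (nth-ext (suc-injective eq) (λ i i<n → pt (suc i) (s≤s i<n)))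

nth-∈ : ∀ (xs : List ℕ) {i} → i < length xs → nth xs i ∈ xs
nth-∈ (x ∷ xs) {zero}  _         = here refl
nth-∈ (x ∷ xs) {suc i} (s≤s i<n) = there (nth-∈ xs i<n)

∈⇒nth : ∀ {x} {xs : List ℕ} → x ∈ xs → ∃ λ i → i < length xs × nth xs i ≡ x
∈⇒nth (here refl) = 0 , z<s , refl
∈⇒nth (there x∈)  with ∈⇒nth x∈
... | i , i<n , eq = suc i , s≤s i<n , eq

nth-injective : ∀ {xs : List ℕ} → Unique xs → ∀ {i j} → i < length xs → j < length xs →
                nth xs i ≡ nth xs j → i ≡ j
nth-injective {x ∷ xs} _          {zero}  {zero}  _         _         _  = refl
nth-injective {x ∷ xs} (x∉ ∷ _)   {zero}  {suc j} _         (s≤s j<n) eq =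
  ⊥-elim (All.lookup x∉ (nth-∈ xs j<n) eq)
nth-injective {x ∷ xs} (x∉ ∷ _)   {suc i} {zero}  (s≤s i<n) _         eq =
  ⊥-elim (All.lookup x∉ (nth-∈ xs i<n) (sym eq))
nth-injective {x ∷ xs} (_ ∷ uniq) {suc i} {suc j} (s≤s i<n) (s≤s j<n) eq =
  cong suc (nth-injective uniq i<n j<n eq)

mod′-< : ∀ i {n} → 0 < n → i mod′ n < n
mod′-< i {suc n} _ = m%n<n i (suc n)

cyc-< : ∀ (σ : List ℕ) {i} → i < length σ → cyc σ i ≡ nth σ i
cyc-< σ {i} i<n with length σ
... | suc n = cong (nth σ) (m<n⇒m%n≡m i<n)

cyc-+length : ∀ (σ : List ℕ) i → cyc σ (length σ + i) ≡ cyc σ i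
cyc-+length σ i with length σ
... | zero  = refl
... | suc n = cong (nth σ) (trans (cong (_% suc n) (+-comm (suc n) i)) ([m+n]%n≡m%n i (suc n)))

cyc-modʳ : ∀ (σ : List ℕ) i j → cyc σ (i + j mod′ length σ) ≡ cyc σ (i + j)
cyc-modʳ σ i j with length σ
... | zero  = refl
... | suc n = cong (nth σ) (begin
  (i + j % suc n) % suc n               ≡⟨ %-distribˡ-+ i (j % suc n) (suc n) ⟩
  (i % suc n + j % suc n % suc n) % suc n ≡⟨ cong (λ r → (i % suc n + r) % suc n) (m%n%n≡m%n j (suc n)) ⟩
  (i % suc n + j % suc n) % suc n       ≡⟨ %-distribˡ-+ i j (suc n) ⟨
  (i + j) % suc n                       ∎)
  where open ≡-Reasoning

cyc-modˡ : ∀ (σ : List ℕ) i j → cyc σ (i mod′ length σ + j) ≡ cyc σ (i + j)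
cyc-modˡ σ i j = begin
  cyc σ (i mod′ length σ + j) ≡⟨ cong (cyc σ) (+-comm (i mod′ length σ) j) ⟩
  cyc σ (j + i mod′ length σ) ≡⟨ cyc-modʳ σ j i ⟩
  cyc σ (j + i)               ≡⟨ cong (cyc σ) (+-comm j i) ⟩
  cyc σ (i + j)               ∎
  where open ≡-Reasoning

rotate-↭ : ∀ k (σ : List ℕ) → rotate k σ ↭ σ
rotate-↭ k σ = subst (rotate k σ ↭_) (take++drop≡id k σ) (++-comm (drop k σ) (take k σ))

length-rotate : ∀ k (σ : List ℕ) → length (rotate k σ) ≡ length σ
length-rotate k σ = ↭-length (rotate-↭ k σ)

length≡k+length-drop : ∀ {k} (σ : List ℕ) → k ≤ length σ → length σ ≡ k + length (drop k σ)
length≡k+length-drop {k} σ k≤n = trans (sym (m+[n∸m]≡n k≤n)) (cong (k +_) (sym (length-drop k σ)))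

nth-rotate : ∀ {k} (σ : List ℕ) → k ≤ length σ → ∀ {i} → i < length σ →
             nth (rotate k σ) i ≡ cyc σ (k + i)
nth-rotate {k} σ k≤n {i} i<n with i <? length (drop k σ)
... | yes i<d = begin
  nth (drop k σ ++ take k σ) i ≡⟨ nth-++ˡ (drop k σ) (take k σ) i<d ⟩
  nth (drop k σ) i             ≡⟨ nth-drop k σ i ⟩
  nth σ (k + i)                ≡⟨ cyc-< σ (subst (k + i <_) (sym n≡k+d) (+-monoʳ-< k i<d)) ⟨
  cyc σ (k + i)                ∎
  where open ≡-Reasoning
        n≡k+d = length≡k+length-drop σ k≤n
... | no i≮d = begin
  nth (drop k σ ++ take k σ) i       ≡⟨ cong (nth (drop k σ ++ take k σ)) i≡d+j ⟩
  nth (drop k σ ++ take k σ) (d + j) ≡⟨ nth-++ʳ (drop k σ) (take k σ) j ⟩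
  nth (take k σ) j                   ≡⟨ nth-take k σ j<k ⟩
  nth σ j                            ≡⟨ cyc-< σ (<-≤-trans j<k k≤n) ⟨
  cyc σ j                            ≡⟨ cyc-+length σ j ⟨
  cyc σ (length σ + j)               ≡⟨ cong (cyc σ) n+j≡k+i ⟩
  cyc σ (k + i)                      ∎
  where open ≡-Reasoning
        d = length (drop k σ)
        j = i ∸ d
        n≡k+d = length≡k+length-drop σ k≤n
        i≡d+j : i ≡ d + j
        i≡d+j = sym (m+[n∸m]≡n (≮⇒≥ i≮d))
        j<k : j < k
        j<k = +-cancelˡ-< d j k (subst₂ _<_ i≡d+j (trans n≡k+d (+-comm k d)) i<n)
        n+j≡k+i : length σ + j ≡ k + i
        n+j≡k+i = trans (cong (_+ j) n≡k+d) (trans (+-assoc k d j) (cong (k +_) (sym i≡d+j)))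

cyc-rotate : ∀ {k} (σ : List ℕ) → k ≤ length σ → ∀ i → cyc (rotate k σ) i ≡ cyc σ (k + i)
cyc-rotate {zero} [] z≤n i = refl
cyc-rotate {k} σ@(_ ∷ _) k≤n i = begin
  cyc (rotate k σ) i                ≡⟨ cong (λ n → nth (rotate k σ) (i mod′ n)) (length-rotate k σ) ⟩
  nth (rotate k σ) (i mod′ length σ) ≡⟨ nth-rotate σ k≤n (m%n<n i (length σ)) ⟩
  cyc σ (k + i mod′ length σ)        ≡⟨ cyc-modʳ σ k i ⟩
  cyc σ (k + i)                      ∎
  where open ≡-Reasoning

head-rotate : ∀ {k} (σ : List ℕ) → k < length σ → nth (rotate k σ) 0 ≡ nth σ k
head-rotate {k} σ k<n = begin
  nth (rotate k σ) 0 ≡⟨ nth-rotate σ (<⇒≤ k<n) (<-≤-trans z<s k<n) ⟩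
  cyc σ (k + 0)      ≡⟨ cong (cyc σ) (+-identityʳ k) ⟩
  cyc σ k            ≡⟨ cyc-< σ k<n ⟩
  nth σ k            ∎
  where open ≡-Reasoning

rotate-≡ : ∀ {k} (σ τ : List ℕ) → k ≤ length σ → length τ ≡ length σ →
           (∀ i → i < length σ → cyc σ (k + i) ≡ nth τ i) → rotate k σ ≡ τ
rotate-≡ {k} σ τ k≤n eq pt =
  nth-ext (trans (length-rotate k σ) (sym eq)) λ i i<n →
    let i<n′ = subst (i <_) (length-rotate k σ) i<n
    in trans (nth-rotate σ k≤n i<n′) (pt i i<n′)

∼rot⁻ : ∀ {σ τ : List ℕ} → σ ∼rot τ → ∃ λ k → k < length σ × τ ≡ rotate k σ
∼rot⁻ p with find p
... | k , k∈ , eq = k , ∈-upTo⁻ k∈ , eq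

∼rot⁺ : ∀ {k} (σ : List ℕ) → k < length σ → σ ∼rot rotate k σ
∼rot⁺ σ k<n = lose (∈-upTo⁺ k<n) refl

∼rot-refl : ∀ {x} {σ : List ℕ} → (x ∷ σ) ∼rot (x ∷ σ)
∼rot-refl {x} {σ} = subst ((x ∷ σ) ∼rot_) (++-identityʳ (x ∷ σ)) (∼rot⁺ (x ∷ σ) z<s)

∼rot-sym : ∀ {σ τ : List ℕ} → σ ∼rot τ → τ ∼rot σ
∼rot-sym {σ} p with ∼rot⁻ p
... | k , k<n , refl = subst (rotate k σ ∼rot_) back (∼rot⁺ (rotate k σ) a<n′)
  where
  open ≡-Reasoning
  n = length σ
  a = (n ∸ k) mod′ n
  a<n : a < n
  a<n = mod′-< (n ∸ k) (<-≤-trans z<s k<n)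
  a<n′ : a < length (rotate k σ)
  a<n′ = subst (a <_) (sym (length-rotate k σ)) a<n
  back : rotate a (rotate k σ) ≡ σ
  back = rotate-≡ (rotate k σ) σ (<⇒≤ a<n′) (sym (length-rotate k σ)) λ i i<n → begin
    cyc (rotate k σ) (a + i) ≡⟨ cyc-rotate σ (<⇒≤ k<n) (a + i) ⟩
    cyc σ (k + (a + i))     ≡⟨ cong (cyc σ) (x∙yz≈y∙xz k a i) ⟩
    cyc σ (a + (k + i))     ≡⟨ cyc-modˡ σ (n ∸ k) (k + i) ⟩
    cyc σ (n ∸ k + (k + i)) ≡⟨ cong (cyc σ) (+-assoc (n ∸ k) k i) ⟨
    cyc σ (n ∸ k + k + i)   ≡⟨ cong (λ j → cyc σ (j + i)) (m∸n+n≡m (<⇒≤ k<n)) ⟩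
    cyc σ (n + i)           ≡⟨ cyc-+length σ i ⟩
    cyc σ i                 ≡⟨ cyc-< σ (subst (i <_) (length-rotate k σ) i<n) ⟩
    nth σ i                 ∎

∼rot-trans : ∀ {σ τ ρ : List ℕ} → σ ∼rot τ → τ ∼rot ρ → σ ∼rot ρ
∼rot-trans {σ} p q with ∼rot⁻ p | ∼rot⁻ q
... | b , b<n , refl | a , a<n , refl = subst (σ ∼rot_) rotations-compose (∼rot⁺ σ c<n)
  where
  open ≡-Reasoning
  c = (b + a) mod′ length σ
  c<n : c < length σ
  c<n = mod′-< (b + a) (<-≤-trans z<s b<n)
  |ρ|≡n : length σ ≡ length (rotate b σ)
  |ρ|≡n = sym (length-rotate b σ)
  rotations-compose : rotate c σ ≡ rotate a (rotate b σ)
  rotations-compose =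
    rotate-≡ σ _ (<⇒≤ c<n) (trans (length-rotate a (rotate b σ)) (length-rotate b σ)) λ i i<n → begin
      cyc σ (c + i)                 ≡⟨ cyc-modˡ σ (b + a) i ⟩
      cyc σ (b + a + i)             ≡⟨ cong (cyc σ) (+-assoc b a i) ⟩
      cyc σ (b + (a + i))           ≡⟨ cyc-rotate σ (<⇒≤ b<n) (a + i) ⟨
      cyc (rotate b σ) (a + i)      ≡⟨ nth-rotate (rotate b σ) (<⇒≤ a<n) (subst (i <_) |ρ|≡n i<n) ⟨
      nth (rotate a (rotate b σ)) i ∎

∼rot-head-injective : ∀ {x} {σ τ : List ℕ} → Unique (x ∷ σ) → (x ∷ σ) ∼rot (x ∷ τ) → σ ≡ τ
∼rot-head-injective {x} {σ} uniq p with ∼rot⁻ p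
... | zero  , _   , eq = sym (∷-injectiveʳ (trans eq (++-identityʳ (x ∷ σ))))
... | suc k , k<n , eq = ⊥-elim (0≢1+n (sym (nth-injective uniq k<n z<s xₖ≡x)))
  where
  xₖ≡x : nth (x ∷ σ) (suc k) ≡ x
  xₖ≡x = trans (sym (head-rotate (x ∷ σ) k<n)) (cong (λ l → nth l 0) (sym eq))

concatMap-map≡cartesianProductWith : ∀ {A B C : Set} (f : A → B → C) xs ys →
  concatMap (λ x → map (f x) ys) xs ≡ cartesianProductWith f xs ys
concatMap-map≡cartesianProductWith f []       ys = refl
concatMap-map≡cartesianProductWith f (x ∷ xs) ys =
  cong (map (f x) ys ++_) (concatMap-map≡cartesianProductWith f xs ys)

words-suc : ∀ n k → words n (suc k) ≡ cartesianProductWith _∷_ (upTo n) (words n k)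
words-suc n k = concatMap-map≡cartesianProductWith _∷_ (upTo n) (words n k)

∈-words⁻ : ∀ {n k} {σ : List ℕ} → σ ∈ words n k → length σ ≡ k × All (_< n) σ
∈-words⁻ {k = zero}  (here refl) = refl , []
∈-words⁻ {n} {suc k} {σ} σ∈
  with ∈-cartesianProductWith⁻ _∷_ (upTo n) (words n k) (subst (σ ∈_) (words-suc n k) σ∈)
... | i , τ , i∈ , τ∈ , refl with ∈-words⁻ {n} {k} τ∈
... | len , τ<n = cong suc len , ∈-upTo⁻ i∈ ∷ τ<n

∈-words⁺ : ∀ {n k} {σ : List ℕ} → length σ ≡ k → All (_< n) σ → σ ∈ words n k
∈-words⁺ {k = zero}  {[]}    refl []          = here refl
∈-words⁺ {n} {suc k} {i ∷ σ} len  (i<n ∷ σ<n) = subst ((i ∷ σ) ∈_) (sym (words-suc n k))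
  (∈-cartesianProductWith⁺ _∷_ (∈-upTo⁺ i<n) (∈-words⁺ (suc-injective len) σ<n))

Unique-words : ∀ n k → Unique (words n k)
Unique-words n zero    = [] ∷ []
Unique-words n (suc k) = subst Unique (sym (words-suc n k))
  (Unique.cartesianProductWith⁺ _∷_ ∷-injective (Unique.upTo⁺ n) (Unique-words n k))

∈S⁻ : ∀ {n} {σ : List ℕ} → σ ∈ S n → length σ ≡ n × All (_< n) σ × Unique σ
∈S⁻ {n} σ∈ with ∈-filter⁻ (UniqueDec.unique? _≟_) σ∈
... | σ∈words , uniq with ∈-words⁻ {n} {n} σ∈words
... | len , σ<n = len , σ<n , uniq

∈S⁺ : ∀ {n} {σ : List ℕ} → length σ ≡ n → All (_< n) σ → Unique σ → σ ∈ S n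
∈S⁺ len σ<n uniq = ∈-filter⁺ (UniqueDec.unique? _≟_) (∈-words⁺ len σ<n) uniq

Unique-S : ∀ n → Unique (S n)
Unique-S n = Unique.filter⁺ (UniqueDec.unique? _≟_) (Unique-words n n)

∈S-rotate : ∀ {n} k {σ : List ℕ} → σ ∈ S n → rotate k σ ∈ S n
∈S-rotate {n} k {σ} σ∈ with ∈S⁻ {n} σ∈
... | len , σ<n , uniq = ∈S⁺ (trans (length-rotate k σ) len) (All-resp-↭ (↭-sym (rotate-↭ k σ)) σ<n)
                             (Unique-resp-↭ (setoid ℕ) (↭⇒↭ₛ (↭-sym (rotate-↭ k σ))) uniq)

Unique⇒length≤ : ∀ {k} {xs : List ℕ} → Unique xs → All (_< k) xs → length xs ≤ k
Unique⇒length≤ {k} {xs} uniq xs<k = injective⇒≤ {f = f} f-injective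
  where
  f : Fin (length xs) → Fin k
  f i = fromℕ< (All.lookup xs<k (nth-∈ xs (toℕ<n i)))
  f-injective : Injective _≡_ _≡_ f
  f-injective {i} {j} fi≡fj = toℕ-injective (nth-injective uniq (toℕ<n i) (toℕ<n j)
    (trans (sym (toℕ-fromℕ< _)) (trans (cong toℕ fi≡fj) (toℕ-fromℕ< _))))

max∈S : ∀ {m} {σ : List ℕ} → σ ∈ S (suc m) → m ∈ σ
max∈S {m} {σ} σ∈ with m ∈? σ | ∈S⁻ {suc m} σ∈
... | yes m∈ | _               = m∈
... | no  m∉ | len , σ<n , uniq = ⊥-elim (<-irrefl refl (subst (_≤ m) len (Unique⇒length≤ uniq σ<m)))
  where
  σ<m : All (_< m) σ
  σ<m = All.tabulate λ {y} y∈ → ≤∧≢⇒< (≤-pred (All.lookup σ<n y∈)) λ { refl → m∉ y∈ }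

∷-∈S⁻ : ∀ {m} {τ : List ℕ} → (m ∷ τ) ∈ S (suc m) → τ ∈ S m
∷-∈S⁻ {m} mτ∈ with ∈S⁻ {suc m} mτ∈
... | len , _ ∷ τ<n , m∉τ ∷ uniq =
  ∈S⁺ (suc-injective len) (All.zipWith (λ (y<n , m≢y) → ≤∧≢⇒< (≤-pred y<n) (m≢y ∘ sym)) (τ<n , m∉τ))
      uniq

∷-∈S⁺ : ∀ {m} {τ : List ℕ} → τ ∈ S m → (m ∷ τ) ∈ S (suc m)
∷-∈S⁺ {m} τ∈ with ∈S⁻ {m} τ∈
... | len , τ<m , uniq = ∈S⁺ (cong suc len) (n<1+n _ ∷ All.map m<n⇒m<1+n τ<m)
                             (All.map (λ y<m m≡y → <-irrefl (sym m≡y) y<m) τ<m ∷ uniq)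

∈S-maxFirst : ∀ {m} {σ : List ℕ} → σ ∈ S (suc m) → ∃ λ τ → τ ∈ S m × σ ∼rot (m ∷ τ)
∈S-maxFirst {m} {σ} σ∈ with ∈⇒nth (max∈S {m} σ∈)
... | k , k<n , σₖ≡m =
  maxFirst (rotate k σ) (∈S-rotate {suc m} k σ∈) (trans (head-rotate σ k<n) σₖ≡m) (∼rot⁺ σ k<n)
  where
  maxFirst : ∀ ρ → ρ ∈ S (suc m) → nth ρ 0 ≡ m → σ ∼rot ρ → ∃ λ τ → τ ∈ S m × σ ∼rot (m ∷ τ)
  maxFirst []      ρ∈ _    _ with () ← proj₁ (∈S⁻ {suc m} ρ∈)
  maxFirst (_ ∷ τ) ρ∈ refl σ∼ρ = τ , ∷-∈S⁻ ρ∈ , σ∼ρ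

-- Counting classes through a system of representatives

module _ {A : Set} where

  filter-cong-∈ : ∀ {P Q : A → Set} (P? : Decidable P) (Q? : Decidable Q) (xs : List A) →
                  (∀ {x} → x ∈ xs → P x → Q x) → (∀ {x} → x ∈ xs → Q x → P x) →
                  filter P? xs ≡ filter Q? xs
  filter-cong-∈ P? Q? []       _   _   = refl
  filter-cong-∈ P? Q? (x ∷ xs) P⇒Q Q⇒P with P? x | Q? x
  ... | yes _  | yes _  = cong (x ∷_) (filter-cong-∈ P? Q? xs (P⇒Q ∘ there) (Q⇒P ∘ there))
  ... | no  _  | no  _  = filter-cong-∈ P? Q? xs (P⇒Q ∘ there) (Q⇒P ∘ there)
  ... | yes px | no ¬qx = ⊥-elim (¬qx (P⇒Q (here refl) px))
  ... | no ¬px | yes qx = ⊥-elim (¬px (Q⇒P (here refl) qx))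

  length-filter-insert : ∀ {P Q : A → Set} (P? : Decidable P) (Q? : Decidable Q) {xs : List A} →
    Unique xs → ∀ {x₀} → x₀ ∈ xs → Q x₀ → ¬ P x₀ →
    (∀ {x} → x ∈ xs → x ≢ x₀ → P x → Q x) → (∀ {x} → x ∈ xs → x ≢ x₀ → Q x → P x) →
    length (filter Q? xs) ≡ suc (length (filter P? xs))
  length-filter-insert P? Q? {x ∷ xs} (x∉ ∷ _) (here refl) qx₀ ¬px₀ P⇒Q Q⇒P with P? x | Q? x
  ... | yes px | _      = ⊥-elim (¬px₀ px)
  ... | no  _  | no ¬qx = ⊥-elim (¬qx qx₀)
  ... | no  _  | yes _  = cong suc (cong length (filter-cong-∈ Q? P? xs
    (λ x∈ → Q⇒P (there x∈) (All.lookup x∉ x∈ ∘ sym))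
    (λ x∈ → P⇒Q (there x∈) (All.lookup x∉ x∈ ∘ sym))))
  length-filter-insert P? Q? {x ∷ xs} (x∉ ∷ uniq) (there x₀∈) qx₀ ¬px₀ P⇒Q Q⇒P with P? x | Q? x
  ... | yes _  | yes _  =
    cong suc (length-filter-insert P? Q? uniq x₀∈ qx₀ ¬px₀ (P⇒Q ∘ there) (Q⇒P ∘ there))
  ... | no  _  | no  _  = length-filter-insert P? Q? uniq x₀∈ qx₀ ¬px₀ (P⇒Q ∘ there) (Q⇒P ∘ there)
  ... | yes px | no ¬qx = ⊥-elim (¬qx (P⇒Q (here refl) (All.lookup x∉ x₀∈) px))
  ... | no ¬px | yes qx = ⊥-elim (¬px (Q⇒P (here refl) (All.lookup x∉ x₀∈) qx))

module _ {A : Set} {R : A → A → Set} (R? : ∀ x y → Dec (R x y))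
         (R-sym : ∀ {x y} → R x y → R y x) (R-trans : ∀ {x y z} → R x y → R y z → R x z)
         {reps : List A} (reps-unique : Unique reps)
         (reps-distinct : ∀ {r r′} → r ∈ reps → r′ ∈ reps → R r r′ → r ≡ r′) where

  -- Prepending x adds one to numClasses exactly when the class of x is not met by xs,
  -- i.e. exactly when one more representative becomes met.
  numClasses≡length-filter-met : ∀ (xs : List A) → (∀ {x} → x ∈ xs → ∃ λ r → r ∈ reps × R r x) →
                                 numClasses R? xs ≡ length (filter (λ r → any? (R? r) xs) reps)
  numClasses≡length-filter-met []       _     =
    sym (cong length (filter-none (λ r → any? (R? r) []) {reps} (All.tabulate λ _ ())))
  numClasses≡length-filter-met (x ∷ xs) cover with any? (R? x) xs
  ... | yes x∼xs = trans (numClasses≡length-filter-met xs (cover ∘ there))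
                         (cong length (filter-cong-∈ _ _ reps (λ _ → there) met-by-xs))
    where
    met-by-xs : ∀ {r} → r ∈ reps → Any (R r) (x ∷ xs) → Any (R r) xs
    met-by-xs _ (here r∼x)  = Any.map (R-trans r∼x) x∼xs
    met-by-xs _ (there r∼xs) = r∼xs
  ... | no x≁xs with cover (here refl)
  ... | r₀ , r₀∈ , r₀∼x = trans (cong suc (numClasses≡length-filter-met xs (cover ∘ there)))
    (sym (length-filter-insert _ _ reps-unique r₀∈ (here r₀∼x) r₀≁xs (λ _ _ → there) met-by-xs))
    where
    r₀≁xs : ¬ Any (R r₀) xs
    r₀≁xs = x≁xs ∘ Any.map (R-trans (R-sym r₀∼x))
    met-by-xs : ∀ {r} → r ∈ reps → r ≢ r₀ → Any (R r) (x ∷ xs) → Any (R r) xs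
    met-by-xs r∈ r≢r₀ (here r∼x)  = ⊥-elim (r≢r₀ (reps-distinct r∈ r₀∈ (R-trans r∼x (R-sym r₀∼x))))
    met-by-xs _  _    (there r∼xs) = r∼xs

  numClasses-representatives : ∀ (xs : List A) → (∀ {x} → x ∈ xs → ∃ λ r → r ∈ reps × R r x) →
                               (∀ {r} → r ∈ reps → Any (R r) xs) → numClasses R? xs ≡ length reps
  numClasses-representatives xs cover met =
    trans (numClasses≡length-filter-met xs cover) (cong length (filter-all _ (All.tabulate met)))

-- Monotone runs of three consecutive entries

-- Occ123/Contains123 and Occ321/Contains321 are CyclicRun/ContainsRun at _<_ and _>_ definitionally,
-- so Avoids σ unfolds to ¬ ContainsRun _<_ σ × ¬ ContainsRun _>_ σ.
CyclicRun : (ℕ → ℕ → Set) → List ℕ → ℕ → Set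
CyclicRun _R_ σ i = cyc σ i R cyc σ (suc i) × cyc σ (suc i) R cyc σ (suc (suc i))

ContainsRun : (ℕ → ℕ → Set) → List ℕ → Set
ContainsRun R σ = 3 ≤ length σ × Any (CyclicRun R σ) (upTo (length σ))

ContainsRun-rotate : ∀ {R k} (σ : List ℕ) → k ≤ length σ → ContainsRun R (rotate k σ) → ContainsRun R σ
ContainsRun-rotate {R} {k} σ k≤n (3≤n′ , run) with find run
... | i , _ , (r₀ , r₁) =
  3≤n , lose (∈-upTo⁺ j<n) (subst₂ R (shift 0) (shift 1) r₀ , subst₂ R (shift 1) (shift 2) r₁)
  where
  open ≡-Reasoning
  3≤n = subst (3 ≤_) (length-rotate k σ) 3≤n′
  j = (k + i) mod′ length σ
  j<n : j < length σ
  j<n = mod′-< (k + i) (<-≤-trans z<s 3≤n)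
  shift : ∀ t → cyc (rotate k σ) (t + i) ≡ cyc σ (t + j)
  shift t = begin
    cyc (rotate k σ) (t + i) ≡⟨ cyc-rotate σ k≤n (t + i) ⟩
    cyc σ (k + (t + i))      ≡⟨ cong (cyc σ) (x∙yz≈y∙xz k t i) ⟩
    cyc σ (t + (k + i))      ≡⟨ cyc-modʳ σ t (k + i) ⟨
    cyc σ (t + j)            ∎

Avoids-∼rot : ∀ {σ τ : List ℕ} → σ ∼rot τ → Avoids σ → Avoids τ
Avoids-∼rot {σ} p (¬123 , ¬321) with ∼rot⁻ p
... | k , k<n , refl = ¬123 ∘ ContainsRun-rotate {_<_} σ (<⇒≤ k<n)
                     , ¬321 ∘ ContainsRun-rotate {_>_} σ (<⇒≤ k<n)

data MonotoneRun (_R_ : ℕ → ℕ → Set) : List ℕ → Set where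
  here  : ∀ {x y z l} → x R y → y R z → MonotoneRun _R_ (x ∷ y ∷ z ∷ l)
  there : ∀ {x l} → MonotoneRun _R_ l → MonotoneRun _R_ (x ∷ l)

MonotoneRun-++ : ∀ {R} {xs : List ℕ} ys → MonotoneRun R xs → MonotoneRun R (xs ++ ys)
MonotoneRun-++ ys (here r₀ r₁) = here r₀ r₁
MonotoneRun-++ ys (there run)  = there (MonotoneRun-++ ys run)

MonotoneRun⇒3≤length : ∀ {R} {l : List ℕ} → MonotoneRun R l → 3 ≤ length l
MonotoneRun⇒3≤length (here _ _)  = s≤s (s≤s (s≤s z≤n))
MonotoneRun⇒3≤length (there run) = m≤n⇒m≤1+n (MonotoneRun⇒3≤length run)

MonotoneRun-at : ∀ {R} (l : List ℕ) i → suc (suc i) < length l →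
                 R (nth l i) (nth l (suc i)) → R (nth l (suc i)) (nth l (suc (suc i))) →
                 MonotoneRun R l
MonotoneRun-at (x ∷ y ∷ z ∷ l) zero    _         r₀ r₁ = here r₀ r₁
MonotoneRun-at (x ∷ y ∷ [])    zero    (s≤s (s≤s ())) _ _
MonotoneRun-at (x ∷ l)         (suc i) (s≤s i<n) r₀ r₁ = there (MonotoneRun-at l i i<n r₀ r₁)

MonotoneRun-index : ∀ {R} {l : List ℕ} → MonotoneRun R l →
                    ∃ λ i → suc (suc i) < length l ×
                            R (nth l i) (nth l (suc i)) × R (nth l (suc i)) (nth l (suc (suc i)))
MonotoneRun-index (here r₀ r₁) = 0 , s≤s (s≤s z<s) , r₀ , r₁
MonotoneRun-index (there run) with MonotoneRun-index run
... | i , i<n , r = suc i , s≤s i<n , r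

cyc≡nth-++take : ∀ (σ : List ℕ) k {j} → j < length (σ ++ take k σ) → cyc σ j ≡ nth (σ ++ take k σ) j
cyc≡nth-++take σ k {j} j<n with j <? length σ
... | yes j<L = trans (cyc-< σ j<L) (sym (nth-++ˡ σ (take k σ) j<L))
... | no j≮L = begin
  cyc σ j                          ≡⟨ cong (cyc σ) j≡L+t ⟩
  cyc σ (length σ + t)             ≡⟨ cyc-+length σ t ⟩
  cyc σ t                          ≡⟨ cyc-< σ t<n ⟩
  nth σ t                          ≡⟨ nth-take k σ t<k ⟨
  nth (take k σ) t                 ≡⟨ nth-++ʳ σ (take k σ) t ⟨
  nth (σ ++ take k σ) (length σ + t) ≡⟨ cong (nth (σ ++ take k σ)) j≡L+t ⟨
  nth (σ ++ take k σ) j            ∎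
  where
  open ≡-Reasoning
  t = j ∸ length σ
  j≡L+t : j ≡ length σ + t
  j≡L+t = sym (m+[n∸m]≡n (≮⇒≥ j≮L))
  t<take : t < k ⊓ length σ
  t<take = +-cancelˡ-< (length σ) t _
    (subst₂ _<_ j≡L+t (trans (length-++ σ) (cong (length σ +_) (length-take k σ))) j<n)
  t<n : t < length σ
  t<n = <-≤-trans t<take (m⊓n≤n k (length σ))
  t<k : t < k
  t<k = <-≤-trans t<take (m⊓n≤m k (length σ))

length-++take2 : ∀ (σ : List ℕ) → 2 ≤ length σ → length (σ ++ take 2 σ) ≡ 2 + length σ
length-++take2 σ 2≤n = begin
  length (σ ++ take 2 σ)        ≡⟨ length-++ σ ⟩
  length σ + length (take 2 σ)  ≡⟨ cong (length σ +_) (trans (length-take 2 σ) (m≤n⇒m⊓n≡m 2≤n)) ⟩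
  length σ + 2                  ≡⟨ +-comm (length σ) 2 ⟩
  2 + length σ                  ∎
  where open ≡-Reasoning

cyc≡nth-++take2 : ∀ (σ : List ℕ) {t i} → t ≤ 2 → 2 + i < length (σ ++ take 2 σ) →
                  cyc σ (t + i) ≡ nth (σ ++ take 2 σ) (t + i)
cyc≡nth-++take2 σ {t} {i} t≤2 2+i<n = cyc≡nth-++take σ 2 (≤-<-trans (+-monoˡ-≤ i t≤2) 2+i<n)

ContainsRun⇒MonotoneRun : ∀ {R} (σ : List ℕ) → ContainsRun R σ → MonotoneRun R (σ ++ take 2 σ)
ContainsRun⇒MonotoneRun {R} σ (3≤n , run) with find run
... | i , i∈ , (r₀ , r₁) = MonotoneRun-at (σ ++ take 2 σ) i 2+i<n
  (subst₂ R (e 0 z≤n) (e 1 (s≤s z≤n)) r₀) (subst₂ R (e 1 (s≤s z≤n)) (e 2 ≤-refl) r₁)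
  where
  2+i<n : 2 + i < length (σ ++ take 2 σ)
  2+i<n = subst (2 + i <_) (sym (length-++take2 σ (≤-trans (n≤1+n 2) 3≤n))) (s≤s (s≤s (∈-upTo⁻ i∈)))
  e : ∀ t → t ≤ 2 → cyc σ (t + i) ≡ nth (σ ++ take 2 σ) (t + i)
  e t t≤2 = cyc≡nth-++take2 σ t≤2 2+i<n

MonotoneRun⇒ContainsRun : ∀ {R} (σ : List ℕ) → 3 ≤ length σ → MonotoneRun R (σ ++ take 2 σ) →
                          ContainsRun R σ
MonotoneRun⇒ContainsRun {R} σ 3≤n run with MonotoneRun-index run
... | i , 2+i<n , r₀ , r₁ = 3≤n , lose (∈-upTo⁺ i<n)
  (subst₂ R (e 0 z≤n) (e 1 (s≤s z≤n)) r₀ , subst₂ R (e 1 (s≤s z≤n)) (e 2 ≤-refl) r₁)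
  where
  i<n : i < length σ
  i<n = ≤-pred (≤-pred (subst (2 + i <_) (length-++take2 σ (≤-trans (n≤1+n 2) 3≤n)) 2+i<n))
  e : ∀ t → t ≤ 2 → nth (σ ++ take 2 σ) (t + i) ≡ cyc σ (t + i)
  e t t≤2 = sym (cyc≡nth-++take2 σ t≤2 2+i<n)

RunFree : List ℕ → Set
RunFree l = ¬ MonotoneRun _<_ l × ¬ MonotoneRun _>_ l

Avoids⇒RunFree : ∀ (σ : List ℕ) → Avoids σ → RunFree σ
Avoids⇒RunFree σ (¬123 , ¬321) = ¬123 ∘ linear⇒cyclic , ¬321 ∘ linear⇒cyclic
  where
  linear⇒cyclic : ∀ {R} → MonotoneRun R σ → ContainsRun R σ
  linear⇒cyclic run = MonotoneRun⇒ContainsRun σ (MonotoneRun⇒3≤length run) (MonotoneRun-++ (take 2 σ) run)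

-- Up-down words are the alternating ones

mutual
  Up-¬run< : ∀ {l} → Up l → ¬ MonotoneRun _<_ l
  Up-¬run< (_ , y>z , _) (here _ y<z)          = <-asym y<z y>z
  Up-¬run< {_ ∷ _ ∷ _} (_ , down) (there run)  = Down-¬run< down run
  Up-¬run< {_ ∷ []}    _          (there ())

  Up-¬run> : ∀ {l} → Up l → ¬ MonotoneRun _>_ l
  Up-¬run> (x<y , _) (here x>y _)              = <-asym x<y x>y
  Up-¬run> {_ ∷ _ ∷ _} (_ , down) (there run)  = Down-¬run> down run
  Up-¬run> {_ ∷ []}    _          (there ())

  Down-¬run< : ∀ {l} → Down l → ¬ MonotoneRun _<_ l
  Down-¬run< (x>y , _) (here x<y _)            = <-asym x<y x>y
  Down-¬run< {_ ∷ _ ∷ _} (_ , up) (there run)  = Up-¬run< up run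
  Down-¬run< {_ ∷ []}    _        (there ())

  Down-¬run> : ∀ {l} → Down l → ¬ MonotoneRun _>_ l
  Down-¬run> (_ , y<z , _) (here _ y>z)        = <-asym y<z y>z
  Down-¬run> {_ ∷ _ ∷ _} (_ , up) (there run)  = Up-¬run> up run
  Down-¬run> {_ ∷ []}    _        (there ())

mutual
  RunFree⇒Up : ∀ {x y l} → x > y → Unique (y ∷ l) → RunFree (x ∷ y ∷ l) → Up (y ∷ l)
  RunFree⇒Up {l = []}    _   _                     _           = tt
  RunFree⇒Up {x} {y} {z ∷ l} x>y ((y≢z ∷ _) ∷ uniq) (¬run< , ¬run>) =
    y<z , RunFree⇒Down y<z uniq (¬run< ∘ there , ¬run> ∘ there)
    where
    y<z : y < z
    y<z = ≤∧≢⇒< (≮⇒≥ (λ z<y → ¬run> (here x>y z<y))) y≢z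

  RunFree⇒Down : ∀ {x y l} → x < y → Unique (y ∷ l) → RunFree (x ∷ y ∷ l) → Down (y ∷ l)
  RunFree⇒Down {l = []}    _   _                     _           = tt
  RunFree⇒Down {x} {y} {z ∷ l} x<y ((y≢z ∷ _) ∷ uniq) (¬run< , ¬run>) =
    z<y , RunFree⇒Up z<y uniq (¬run< ∘ there , ¬run> ∘ there)
    where
    z<y : z < y
    z<y = ≤∧≢⇒< (≮⇒≥ (λ y<z → ¬run< (here x<y y<z))) (y≢z ∘ sym)

-- (2 + k) % 2 evaluates to k % 2, which is what lets the next two recursions step by two.
Up-++-peak : ∀ {m b} (τ : List ℕ) → Up τ → suc (length τ) % 2 ≡ 0 → All (_< m) τ → b < m →
             Up (τ ++ m ∷ b ∷ [])
Up-++-peak (x ∷ [])         _                 _  (x<m ∷ [])    b<m = x<m , b<m , tt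
Up-++-peak (x ∷ y ∷ z ∷ τ) (x<y , y>z , up) ev (_ ∷ _ ∷ τ<m) b<m =
  x<y , y>z , Up-++-peak (z ∷ τ) up ev τ<m b<m

Up-++-ascent : ∀ {m} x (τ : List ℕ) → Up (x ∷ τ) → suc (length (x ∷ τ)) % 2 ≡ 1 →
               All (_< m) (x ∷ τ) →
               ∀ l → MonotoneRun _<_ (x ∷ τ ++ m ∷ l)
Up-++-ascent x (y ∷ [])        (x<y , _)     _  (_ ∷ y<m ∷ []) l = here x<y y<m
Up-++-ascent x (y ∷ z ∷ w ∷ τ) (_ , _ , up) od (_ ∷ _ ∷ τ<m)  l =
  there (there (Up-++-ascent z (w ∷ τ) up od τ<m l))

-- Representatives with the maximum first

Avoids-maxFirst⇒Up : ∀ {m} {τ : List ℕ} → τ ∈ S m → Avoids (m ∷ τ) → Up τ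
Avoids-maxFirst⇒Up {m} {[]}    _  _      = tt
Avoids-maxFirst⇒Up {m} {t ∷ τ} τ∈ avoids with ∈S⁻ {m} τ∈
... | _ , t<m ∷ _ , uniq = RunFree⇒Up t<m uniq (Avoids⇒RunFree (m ∷ t ∷ τ) avoids)

Up⇒Avoids-maxFirst : ∀ {m} {τ : List ℕ} → All (_< m) τ → Up τ → suc (length τ) % 2 ≡ 0 →
                     Avoids (m ∷ τ)
Up⇒Avoids-maxFirst {m} {t ∷ τ} τ<m@(t<m ∷ _) up ev =
  Down-¬run< cyclicDown ∘ ContainsRun⇒MonotoneRun (m ∷ t ∷ τ) ,
  Down-¬run> cyclicDown ∘ ContainsRun⇒MonotoneRun (m ∷ t ∷ τ)
  where
  cyclicDown : Down ((m ∷ t ∷ τ) ++ take 2 (m ∷ t ∷ τ))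
  cyclicDown = t<m , Up-++-peak (t ∷ τ) up ev τ<m t<m

Up⇒¬Avoids-maxFirst : ∀ {m} {τ : List ℕ} → All (_< m) τ → Up τ → suc (length τ) % 2 ≡ 1 →
                      2 ≤ length τ → ¬ Avoids (m ∷ τ)
Up⇒¬Avoids-maxFirst {m} {t ∷ τ} τ<m up od 2≤n (¬123 , _) =
  ¬123 (MonotoneRun⇒ContainsRun (m ∷ t ∷ τ) (s≤s 2≤n) (there (Up-++-ascent t τ up od τ<m (t ∷ []))))

numAv-odd : ∀ m → 2 ≤ m → suc m % 2 ≡ 1 → numAv (suc m) ≡ 0
numAv-odd m 2≤m od = cong (numClasses _∼rot?_) (filter-none avoids? (All.tabulate noAvoider))
  where
  noAvoider : ∀ {σ} → σ ∈ S (suc m) → ¬ Avoids σ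
  noAvoider σ∈ avoids with ∈S-maxFirst {m} σ∈
  ... | τ , τ∈ , σ∼mτ with ∈S⁻ {m} τ∈
  ... | len , τ<m , _ = Up⇒¬Avoids-maxFirst τ<m (Avoids-maxFirst⇒Up τ∈ avoidsMax)
                          (subst (λ k → suc k % 2 ≡ 1) (sym len) od) (subst (2 ≤_) (sym len) 2≤m) avoidsMax
    where avoidsMax = Avoids-∼rot σ∼mτ avoids

numAv-even : ∀ m → suc m % 2 ≡ 0 → numAv (suc m) ≡ U m
numAv-even m ev = trans
  (numClasses-representatives _∼rot?_ ∼rot-sym ∼rot-trans reps-unique reps-distinct avoiders reps-cover reps-met)
  (length-map (m ∷_) (filter up? (S m)))
  where
  reps = map (m ∷_) (filter up? (S m))
  avoiders = filter avoids? (S (suc m))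

  ∈reps⁻ : ∀ {r} → r ∈ reps → ∃ λ τ → r ≡ m ∷ τ × τ ∈ S m × Up τ
  ∈reps⁻ r∈ with ∈-map⁻ (m ∷_) r∈
  ... | τ , τ∈ , r≡mτ = τ , r≡mτ , ∈-filter⁻ up? τ∈

  rep∈avoiders : ∀ {τ} → τ ∈ S m → Up τ → (m ∷ τ) ∈ avoiders
  rep∈avoiders τ∈ up with ∈S⁻ {m} τ∈
  ... | len , τ<m , _ = ∈-filter⁺ avoids? (∷-∈S⁺ τ∈)
                          (Up⇒Avoids-maxFirst τ<m up (subst (λ k → suc k % 2 ≡ 0) (sym len) ev))

  reps-unique : Unique reps
  reps-unique = Unique.map⁺ ∷-injectiveʳ (Unique.filter⁺ up? (Unique-S m))

  reps-distinct : ∀ {r r′} → r ∈ reps → r′ ∈ reps → r ∼rot r′ → r ≡ r′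
  reps-distinct r∈ r′∈ r∼r′ with ∈reps⁻ r∈ | ∈reps⁻ r′∈
  ... | τ , refl , τ∈ , _ | τ′ , refl , _ , _ with ∈S⁻ {suc m} (∷-∈S⁺ τ∈)
  ... | _ , _ , uniq = cong (m ∷_) (∼rot-head-injective uniq r∼r′)

  reps-cover : ∀ {σ} → σ ∈ avoiders → ∃ λ r → r ∈ reps × r ∼rot σ
  reps-cover σ∈ with ∈-filter⁻ avoids? σ∈
  ... | σ∈S , avoids with ∈S-maxFirst {m} σ∈S
  ... | τ , τ∈ , σ∼mτ =
    m ∷ τ , ∈-map⁺ (m ∷_) (∈-filter⁺ up? τ∈ (Avoids-maxFirst⇒Up τ∈ (Avoids-∼rot σ∼mτ avoids))) , ∼rot-sym σ∼mτ

  reps-met : ∀ {r} → r ∈ reps → Any (r ∼rot_) avoiders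
  reps-met r∈ with ∈reps⁻ r∈
  ... | τ , refl , τ∈ , up = lose (rep∈avoiders τ∈ up) ∼rot-refl

proposition4p2 : (n : ℕ) → 1 ≤ n →
    (n ≡ 1 → numAv n ≡ 1) ×
    (3 ≤ n → n % 2 ≡ 1 → numAv n ≡ 0) ×
    (2 ≤ n → n % 2 ≡ 0 → numAv n ≡ U (n ∸ 1))
proposition4p2 (suc m) _ =
  (λ { refl → refl }) ,
  (λ { (s≤s 2≤m) odd → numAv-odd m 2≤m odd }) ,
  (λ _ even → numAv-even m even)
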